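{- For every $n\geq 1$ there is an orientation of the star with center $v_0$ and leaves $v_1,\ldots,v_n$ (a distar $S_n$) that admits a strong$^*$ SVAL.
   Context: A distar $S_n$ is the star $K_{1,n}$ with center $v_0$ and leaves $v_1,\ldots,v_n$, with each edge given a direction. For a digraph $G=(V,A)$, a total labeling is a bijection $\lambda:V\cup A\to\{1,2,\ldots,|V|+|A|\}$. For a vertex $x$, $wt^-(x)=\lambda(x)+\sum_{yx\in A}\lambda(yx)-\sum_{xy\in A}\lambda(xy)$. An SVAL is a total labeling for which the values $wt^-(x)$, $x\in V$, are pairwise distinct. A total labeling is strong$^*$ if $\lambda(A)=\{1,\ldots,|A|\}$. -}

module Defs where

open import Data.Nat using (ℕ; zero; suc; _+_; _≤_)
open import Data.Integer using (ℤ; +_; _-_) renaming (_+_ to _+ℤ_)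
open import Data.Fin using (Fin; zero; suc; toℕ; _≟_)
open import Data.Bool using (Bool; true; false; if_then_else_)
open import Data.Sum using (_⊎_; inj₁; inj₂)
open import Data.Product using (_×_; ∃; _,_)
open import Relation.Nullary using (does)
open import Relation.Binary.PropositionalEquality using (_≡_; _≢_)
open import Function.Bundles using (_⤖_; Bijection)

record Digraph : Set where
  field
    p : ℕ
    q : ℕ
    tail : Fin q → Fin p
    head : Fin q → Fin p
open Digraph public

Elem : Digraph → Set
Elem G = Fin (p G) ⊎ Fin (q G)

-- A total labeling: a bijection V ∪ A → {1,…,|V|+|A|}.  The codomain is
-- encoded as Fin (|V|+|A|); the label of z is 1 + toℕ (to z).
TotalLabeling : Digraph → Set
TotalLabeling G = Elem G ⤖ Fin (p G + q G)

lab : (G : Digraph) → TotalLabeling G → Elem G → ℕ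
lab G L z = suc (toℕ (Bijection.to L z))

sumFin : (q : ℕ) → (Fin q → ℤ) → ℤ
sumFin zero    f = + 0
sumFin (suc q) f = f zero +ℤ sumFin q (λ i → f (suc i))

wt⁻ : (G : Digraph) → TotalLabeling G → Fin (p G) → ℤ
wt⁻ G L x =
  (+ lab G L (inj₁ x)
    +ℤ sumFin (q G) (λ a → if does (head G a ≟ x) then + lab G L (inj₂ a) else + 0))
    - sumFin (q G) (λ a → if does (tail G a ≟ x) then + lab G L (inj₂ a) else + 0)

IsSVAL : (G : Digraph) → TotalLabeling G → Set
IsSVAL G L = ∀ (x y : Fin (p G)) → x ≢ y → wt⁻ G L x ≢ wt⁻ G L y

IsStrong* : (G : Digraph) → TotalLabeling G → Set
IsStrong* G L =
  (∀ (a : Fin (q G)) → lab G L (inj₂ a) ≤ q G)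
  × (∀ (k : ℕ) → 1 ≤ k → k ≤ q G → ∃ λ (a : Fin (q G)) → lab G L (inj₂ a) ≡ k)

-- The distar S_n: vertices Fin (suc n), v₀ = zero, vᵢ = suc (i-1);
-- arcs Fin n, arc i joins v₀ and leaf (suc i).  The orientation o i = true
-- means the arc is v₀ → leaf, false means leaf → v₀.
distar : (n : ℕ) → (Fin n → Bool) → Digraph
distar n o = record
  { p = suc n
  ; q = n
  ; tail = λ i → if o i then zero else suc i
  ; head = λ i → if o i then suc i else zero
  }

-- Orient every arc away from the centre and label the arcs 1,…,n first and the
-- vertices v₀,…,vₙ with n+1,…,2n+1.  Leaf vᵢ then has weight
-- (n+1+i) + i = n+1+2i, strictly increasing in i and larger than n+1, while the
-- centre has weight (n+1) − (1+⋯+n) ≤ n+1.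
module Submission where

open import Defs
open import Data.Nat using (ℕ; _≤_)
open import Data.Fin using (Fin)
open import Data.Bool using (Bool)
open import Data.Product using (∃; Σ; _×_)

open import Data.Nat using (zero; suc; _+_; _*_; z≤n; s≤s)
import Data.Nat.Properties as ℕ
open import Data.Nat.Tactic.RingSolver using (solve-∀)
open import Data.Fin using (zero; suc; toℕ; cast; fromℕ<; _≟_)
import Data.Fin.Properties as Fin
open import Data.Integer using (ℤ; +_; +≤+; +<+; nonNegative)
  renaming (_+_ to _+ℤ_; _-_ to _-ℤ_; _≤_ to _≤ℤ_; _<_ to _<ℤ_)
import Data.Integer.Properties as ℤ
open import Data.Bool using (true; if_then_else_)
open import Data.Sum using (inj₁; inj₂)
open import Data.Sum.Properties using (swap-↔)
open import Data.Product using (_,_)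
open import Relation.Nullary using (does)
open import Relation.Binary.PropositionalEquality
open import Function.Bundles using (_↔_; mk↔ₛ′)
open import Function.Construct.Composition using (_↔-∘_)
open import Function.Properties.Inverse using (↔⇒⤖; ↔-sym)

cast-↔ : ∀ {m n} → m ≡ n → Fin m ↔ Fin n
cast-↔ m≡n = mk↔ₛ′ (cast m≡n) (cast (sym m≡n))
  (Fin.cast-involutive m≡n (sym m≡n)) (Fin.cast-involutive (sym m≡n) m≡n)

arcsFirst : (G : Digraph) → TotalLabeling G
arcsFirst G = ↔⇒⤖ (cast-↔ (ℕ.+-comm (q G) (p G)) ↔-∘ (↔-sym Fin.+↔⊎ ↔-∘ swap-↔))

module _ (G : Digraph) where

  lab-arcsFirst-arc : ∀ a → lab G (arcsFirst G) (inj₂ a) ≡ suc (toℕ a)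
  lab-arcsFirst-arc a = cong suc (trans (Fin.toℕ-cast _ _) (Fin.toℕ-↑ˡ a (p G)))

  lab-arcsFirst-vertex : ∀ v → lab G (arcsFirst G) (inj₁ v) ≡ suc (q G + toℕ v)
  lab-arcsFirst-vertex v = cong suc (trans (Fin.toℕ-cast _ _) (Fin.toℕ-↑ʳ (q G) v))

  arcsFirst-strong* : IsStrong* G (arcsFirst G)
  arcsFirst-strong* = labels≤q , labelled
    where
    labels≤q : ∀ a → lab G (arcsFirst G) (inj₂ a) ≤ q G
    labels≤q a = subst (_≤ q G) (sym (lab-arcsFirst-arc a)) (Fin.toℕ<n a)

    labelled : ∀ k → 1 ≤ k → k ≤ q G → ∃ λ a → lab G (arcsFirst G) (inj₂ a) ≡ k
    labelled (suc k) _ k<q =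
      fromℕ< k<q , trans (lab-arcsFirst-arc (fromℕ< k<q)) (cong suc (Fin.toℕ-fromℕ< k<q))

sumFin-zero : ∀ m → sumFin m (λ _ → + 0) ≡ + 0
sumFin-zero zero    = refl
sumFin-zero (suc m) = trans (ℤ.+-identityˡ _) (sumFin-zero m)

sumFin-nonNegative : ∀ m (f : Fin m → ℕ) → + 0 ≤ℤ sumFin m (λ a → + f a)
sumFin-nonNegative zero    f = +≤+ z≤n
sumFin-nonNegative (suc m) f =
  ℤ.+-mono-≤ (+≤+ {0} {f zero} z≤n) (sumFin-nonNegative m (λ a → f (suc a)))

sumFin-indicator : ∀ {m} (f : Fin m → ℤ) (j : Fin m) →
  sumFin m (λ a → if does (a ≟ j) then f a else + 0) ≡ f j
sumFin-indicator {suc m} f zero = trans (cong (f zero +ℤ_) (sumFin-zero m)) (ℤ.+-identityʳ (f zero))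
sumFin-indicator {suc m} f (suc j) =
  trans (ℤ.+-identityˡ _) (sumFin-indicator (λ a → f (suc a)) j)

outStar : ℕ → Digraph
outStar n = distar n (λ _ → true)

module _ {n : ℕ} (L : TotalLabeling (outStar n)) where

  private
    λ⟨_⟩ : Elem (outStar n) → ℕ
    λ⟨ z ⟩ = lab (outStar n) L z

  wt⁻-outStar-centre-≤ : wt⁻ (outStar n) L zero ≤ℤ + λ⟨ inj₁ zero ⟩
  wt⁻-outStar-centre-≤ =
    subst (λ w → w -ℤ arcSum ≤ℤ + λ⟨ inj₁ zero ⟩) (sym noInArcs)
      (ℤ.i-j≤i _ arcSum {{nonNegative (sumFin-nonNegative n (λ a → λ⟨ inj₂ a ⟩))}})
    where
    arcSum : ℤ
    arcSum = sumFin n (λ a → + λ⟨ inj₂ a ⟩)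

    noInArcs : + λ⟨ inj₁ zero ⟩ +ℤ sumFin n (λ _ → + 0) ≡ + λ⟨ inj₁ zero ⟩
    noInArcs = trans (cong (+ λ⟨ inj₁ zero ⟩ +ℤ_) (sumFin-zero n)) (ℤ.+-identityʳ _)

  wt⁻-outStar-leaf : ∀ j → wt⁻ (outStar n) L (suc j) ≡ + λ⟨ inj₁ (suc j) ⟩ +ℤ + λ⟨ inj₂ j ⟩
  wt⁻-outStar-leaf j = trans
    (cong₂ (λ s t → (+ λ⟨ inj₁ (suc j) ⟩ +ℤ s) -ℤ t)
      (sumFin-indicator (λ a → + λ⟨ inj₂ a ⟩) j) (sumFin-zero n))
    (ℤ.+-identityʳ _)

module _ (n : ℕ) where

  private
    G : Digraph
    G = outStar n

    L : TotalLabeling G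
    L = arcsFirst G

  wt⁻-arcsFirst-leaf : ∀ j → wt⁻ G L (suc j) ≡ + (3 + (n + 2 * toℕ j))
  wt⁻-arcsFirst-leaf j = begin
    wt⁻ G L (suc j)                           ≡⟨ wt⁻-outStar-leaf L j ⟩
    + lab G L (inj₁ (suc j)) +ℤ + lab G L (inj₂ j)
      ≡⟨ cong₂ (λ x y → + x +ℤ + y) (lab-arcsFirst-vertex G (suc j)) (lab-arcsFirst-arc G j) ⟩
    + (suc (n + suc (toℕ j)) + suc (toℕ j))   ≡⟨ cong +_ (closedForm n (toℕ j)) ⟩
    + (3 + (n + 2 * toℕ j))                   ∎
    where
    open ≡-Reasoning
    closedForm : ∀ n t → suc (n + suc t) + suc t ≡ 3 + (n + 2 * t)
    closedForm = solve-∀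

  wt⁻-arcsFirst-centre<leaf : ∀ j → wt⁻ G L zero <ℤ wt⁻ G L (suc j)
  wt⁻-arcsFirst-centre<leaf j =
    ℤ.≤-<-trans (subst (λ l → wt⁻ G L zero ≤ℤ + l) (lab-arcsFirst-vertex G zero) (wt⁻-outStar-centre-≤ L))
      (subst (+ suc (n + 0) <ℤ_) (sym (wt⁻-arcsFirst-leaf j))
        (+<+ (s≤s (s≤s (ℕ.m≤n⇒m≤1+n (ℕ.+-monoʳ-≤ n z≤n))))))

  wt⁻-arcsFirst-leaf-injective : ∀ i j → wt⁻ G L (suc i) ≡ wt⁻ G L (suc j) → i ≡ j
  wt⁻-arcsFirst-leaf-injective i j eq =
    Fin.toℕ-injective (ℕ.*-cancelˡ-≡ _ _ 2 (ℕ.+-cancelˡ-≡ n _ _ (ℕ.+-cancelˡ-≡ 3 _ _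
      (ℤ.+-injective (trans (sym (wt⁻-arcsFirst-leaf i)) (trans eq (wt⁻-arcsFirst-leaf j)))))))

  outStar-arcsFirst-SVAL : IsSVAL G L
  outStar-arcsFirst-SVAL zero    zero    z≢z _  = z≢z refl
  outStar-arcsFirst-SVAL zero    (suc j) _   eq = ℤ.<-irrefl eq (wt⁻-arcsFirst-centre<leaf j)
  outStar-arcsFirst-SVAL (suc i) zero    _   eq = ℤ.<-irrefl (sym eq) (wt⁻-arcsFirst-centre<leaf i)
  outStar-arcsFirst-SVAL (suc i) (suc j) i≢j eq =
    i≢j (cong suc (wt⁻-arcsFirst-leaf-injective i j eq))

mainTheorem9 : ∀ (n : ℕ) → 1 ≤ n →
    ∃ λ (o : Fin n → Bool) →
      Σ (TotalLabeling (distar n o)) λ L →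
        IsStrong* (distar n o) L × IsSVAL (distar n o) L
mainTheorem9 n _ =
  (λ _ → true) , arcsFirst (outStar n) , arcsFirst-strong* (outStar n) , outStar-arcsFirst-SVAL n
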